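{- Let $A\subseteq\mathrm{Ag}$ and let $\mathsf{L}_1,\mathsf{L}_2$ be logics with fixed-point operators such that $\mathsf{L}_1(\alpha)=\mathsf{L}_2(\alpha)\cup\{T\}$ for $\alpha\in A$ and $\mathsf{L}_1(\alpha)=\mathsf{L}_2(\alpha)$ otherwise, and such that each $\mathsf{L}_2(\alpha)$ is contained in $\{D,B\}$. Then a formula $\varphi$ is $\mathsf{L}_1$-satisfiable if and only if $\mathrm{tr}^{T}_A(\varphi)$ is $\mathsf{L}_2$-satisfiable, where $\mathrm{tr}^T_A$ commutes with all connectives and fixed-point operators (and is the identity on $p,\neg p,\mathtt{tt},\mathtt{ff},X$) except that, for $\alpha\in A$, $\mathrm{tr}^T_A([\alpha]\psi)=[\alpha]\mathrm{tr}^T_A(\psi)\wedge\mathrm{tr}^T_A(\psi)$ and $\mathrm{tr}^T_A(\langle\alpha\rangle\psi)=\langle\alpha\rangle\mathrm{tr}^T_A(\psi)\vee\mathrm{tr}^T_A(\psi)$.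
   Context: Formulas: $\varphi ::= p \mid \neg p \mid \mathtt{tt} \mid \mathtt{ff} \mid X \mid \varphi\wedge\varphi \mid \varphi\vee\varphi \mid \langle\alpha\rangle\varphi \mid [\alpha]\varphi \mid \mu X.\varphi \mid \nu X.\varphi$ over a finite agent set $\mathrm{Ag}$ and finitely many propositional variables; closed formulas only; interpreted on Kripke models $(W,R,V)$, $R\subseteq W\times\mathrm{Ag}\times W$, with the semantics of the multi-agent modal $\mu$-calculus. Frame conditions on $R_\alpha$: $D$ serial, $T$ reflexive, $B$ symmetric. A logic $\mathsf{L}$ assigns to each agent a set $\mathsf{L}(\alpha)$ of conditions; $\mathsf{L}$-models are Kripke models where each $R_\alpha$ satisfies $\mathsf{L}(\alpha)$; $\varphi$ is $\mathsf{L}$-satisfiable if true at some state of some $\mathsf{L}$-model. -}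

module Defs where

open import Level using (Level; 0ℓ) renaming (suc to lsuc)
open import Data.Nat using (ℕ; zero; suc)
open import Data.Fin using (Fin; zero; suc)
open import Data.Fin.Subset using (Subset; _∈_)
open import Data.Fin.Subset.Properties using (_∈?_)
open import Data.Bool using (Bool; true; false; _∨_)
open import Data.Product using (Σ; ∃; _×_; _,_)
open import Data.Sum using (_⊎_)
open import Relation.Nullary using (¬_; yes; no)
open import Relation.Binary.PropositionalEquality using (_≡_)
open import Data.Unit using (⊤)
open import Data.Empty using (⊥)

Lift₁ : Set → Set₁
Lift₁ = Level.Lift (lsuc 0ℓ)

-- Multi-agent modal μ-calculus formulas over agents Fin nAg and
-- propositional variables Fin nP, with k free fixed-point variables
-- (de Bruijn indices: X i refers to the i-th enclosing binder).
data Fm (nAg nP : ℕ) : ℕ → Set where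
  prop  : ∀ {k} → Fin nP → Fm nAg nP k
  nprop : ∀ {k} → Fin nP → Fm nAg nP k
  tt ff : ∀ {k} → Fm nAg nP k
  var   : ∀ {k} → Fin k → Fm nAg nP k
  _∧′_ _∨′_ : ∀ {k} → Fm nAg nP k → Fm nAg nP k → Fm nAg nP k
  dia box : ∀ {k} → Fin nAg → Fm nAg nP k → Fm nAg nP k
  μ′ ν′ : ∀ {k} → Fm nAg nP (suc k) → Fm nAg nP k

Formula : ℕ → ℕ → Set
Formula nAg nP = Fm nAg nP 0

record Model (nAg nP : ℕ) : Set₁ where
  field
    W : Set
    R : W → Fin nAg → W → Set
    V : W → Fin nP → Bool
open Model public

Env : ∀ {nAg nP} → Model nAg nP → ℕ → Set₁
Env M k = Fin k → W M → Set

extend : ∀ {nAg nP} {M : Model nAg nP} {k} → Env M k → (W M → Set) → Env M (suc k)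
extend ρ S zero = S
extend ρ S (suc i) = ρ i

-- Semantics; fixed points by Knaster–Tarski:
--   μX.φ = ⋂ { S | ⟦φ⟧[X↦S] ⊆ S },  νX.φ = ⋃ { S | S ⊆ ⟦φ⟧[X↦S] }.
⟦_⟧ : ∀ {nAg nP k} → Fm nAg nP k → (M : Model nAg nP) → Env M k → W M → Set₁
⟦ prop p ⟧ M ρ w = Lift₁ (V M w p ≡ true)
⟦ nprop p ⟧ M ρ w = Lift₁ (V M w p ≡ false)
⟦ tt ⟧ M ρ w = Lift₁ ⊤
⟦ ff ⟧ M ρ w = Lift₁ ⊥
⟦ var i ⟧ M ρ w = Lift₁ (ρ i w)
⟦ φ ∧′ ψ ⟧ M ρ w = ⟦ φ ⟧ M ρ w × ⟦ ψ ⟧ M ρ w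
⟦ φ ∨′ ψ ⟧ M ρ w = ⟦ φ ⟧ M ρ w ⊎ ⟦ ψ ⟧ M ρ w
⟦ dia a φ ⟧ M ρ w = Σ (W M) λ v → Lift₁ (R M w a v) × ⟦ φ ⟧ M ρ v
⟦ box a φ ⟧ M ρ w = (v : W M) → R M w a v → ⟦ φ ⟧ M ρ v
⟦ μ′ φ ⟧ M ρ w =
  (S : W M → Set) → ((v : W M) → ⟦ φ ⟧ M (extend {M = M} ρ S) v → S v) → S w
⟦ ν′ φ ⟧ M ρ w =
  Σ (W M → Set) λ S → ((v : W M) → S v → ⟦ φ ⟧ M (extend {M = M} ρ S) v) × S w

emptyEnv : ∀ {nAg nP} (M : Model nAg nP) → Env M 0
emptyEnv M = λ ()

_,_⊨_ : ∀ {nAg nP} (M : Model nAg nP) → W M → Formula nAg nP → Set₁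
M , w ⊨ φ = ⟦ φ ⟧ M (emptyEnv M) w

data Cond : Set where
  D T B : Cond

Serial Reflexive Symmetric : ∀ {nAg nP} (M : Model nAg nP) → Fin nAg → Set
Serial M a = (w : W M) → Σ (W M) λ v → R M w a v
Reflexive M a = (w : W M) → R M w a w
Symmetric M a = (w v : W M) → R M w a v → R M v a w

Satisfies : ∀ {nAg nP} (M : Model nAg nP) → Fin nAg → Cond → Set
Satisfies M a D = Serial M a
Satisfies M a T = Reflexive M a
Satisfies M a B = Symmetric M a

Logic : ℕ → Set
Logic nAg = Fin nAg → Cond → Bool

IsLModel : ∀ {nAg nP} → Logic nAg → Model nAg nP → Set
IsLModel L M = (a : Fin _) (c : Cond) → L a c ≡ true → Satisfies M a c

Satisfiable : ∀ {nAg nP} → Logic nAg → Formula nAg nP → Set₁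
Satisfiable {nAg} {nP} L φ =
  Σ (Model nAg nP) λ M → IsLModel L M × Σ (W M) λ w → M , w ⊨ φ

isT : Cond → Bool
isT T = true
isT D = false
isT B = false

tr : ∀ {nAg nP k} → Subset nAg → Fm nAg nP k → Fm nAg nP k
tr A (prop p) = prop p
tr A (nprop p) = nprop p
tr A tt = tt
tr A ff = ff
tr A (var i) = var i
tr A (φ ∧′ ψ) = tr A φ ∧′ tr A ψ
tr A (φ ∨′ ψ) = tr A φ ∨′ tr A ψ
tr A (dia a φ) with a ∈? A
... | yes _ = dia a (tr A φ) ∨′ tr A φ
... | no _  = dia a (tr A φ)
tr A (box a φ) with a ∈? A
... | yes _ = box a (tr A φ) ∧′ tr A φ
... | no _  = box a (tr A φ)
tr A (μ′ φ) = μ′ (tr A φ)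
tr A (ν′ φ) = ν′ (tr A φ)

-- In a model whose accessibility relations are reflexive for the agents in A,
-- [α]ψ is equivalent to [α]ψ ∧ ψ and ⟨α⟩ψ to ⟨α⟩ψ ∨ ψ.  More generally, if N
-- arises from M by adding the identity to R_α for α ∈ A, then tr φ holds in M
-- exactly where φ holds in N.  Taking N = M for an L₁-model M, and N = the
-- reflexive closure on A of an L₂-model M, gives both directions, because
-- adding identity edges preserves seriality, reflexivity and symmetry.
module Submission where

open import Defs
open import Data.Nat using (ℕ)
open import Data.Fin using (Fin)
open import Data.Fin.Subset using (Subset; _∈_; _∉_)
open import Data.Bool using (true; false; _∨_)
open import Relation.Binary.PropositionalEquality using (_≡_)
open import Function.Bundles using (_⇔_)

open import Level using (lift)
open import Data.Bool.Properties using (∨-identityʳ; ∨-zeroʳ)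
open import Data.Fin.Subset.Properties using (_∈?_)
open import Data.Product using (Σ; _×_; _,_)
open import Data.Product.Function.NonDependent.Propositional using (_×-⇔_)
open import Data.Sum using (_⊎_; inj₁; inj₂)
open import Data.Sum.Function.Propositional using (_⊎-⇔_)
open import Data.Empty using (⊥-elim)
open import Function using (_∘_)
open import Function.Bundles using (mk⇔; module Equivalence)
open import Function.Construct.Identity using (⇔-id)
open import Relation.Nullary using (yes; no)
open import Relation.Binary.PropositionalEquality using (refl; sym; trans; cong)

open Equivalence using (to; from)

◇ □ : {X I : Set} → (X → I → X → Set) → I → (X → Set₁) → X → Set₁
◇ R a P x = Σ _ λ y → Lift₁ (R x a y) × P y
□ R a P x = ∀ y → R x a y → P y

module _ {X I : Set} (R R′ : X → I → X → Set) {a : I} {P Q : X → Set₁} {x : X}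
         (P⇔Q : ∀ y → P y ⇔ Q y) where

  ◇-cong : (∀ y → R′ x a y ⇔ R x a y) → ◇ R a P x ⇔ ◇ R′ a Q x
  ◇-cong R′⇔R = mk⇔
    (λ (y , lift r , p) → y , lift (from (R′⇔R y) r) , to (P⇔Q y) p)
    (λ (y , lift r′ , q) → y , lift (to (R′⇔R y) r′) , from (P⇔Q y) q)

  □-cong : (∀ y → R′ x a y ⇔ R x a y) → □ R a P x ⇔ □ R′ a Q x
  □-cong R′⇔R = mk⇔
    (λ f y r′ → to (P⇔Q y) (f y (to (R′⇔R y) r′)))
    (λ g y r → from (P⇔Q y) (g y (from (R′⇔R y) r)))

  module _ (R′⇔R⁼ : ∀ y → R′ x a y ⇔ (R x a y ⊎ x ≡ y)) where

    ◇-reflexiveClosure : (◇ R a P x ⊎ P x) ⇔ ◇ R′ a Q x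
    ◇-reflexiveClosure = mk⇔ forth (λ (y , lift r′ , q) → back y q (to (R′⇔R⁼ y) r′))
      where
        forth : ◇ R a P x ⊎ P x → ◇ R′ a Q x
        forth (inj₁ (y , lift r , p)) = y , lift (from (R′⇔R⁼ y) (inj₁ r)) , to (P⇔Q y) p
        forth (inj₂ p) = x , lift (from (R′⇔R⁼ x) (inj₂ refl)) , to (P⇔Q x) p
        back : ∀ y → Q y → R x a y ⊎ x ≡ y → ◇ R a P x ⊎ P x
        back y q (inj₁ r) = inj₁ (y , lift r , from (P⇔Q y) q)
        back y q (inj₂ refl) = inj₂ (from (P⇔Q x) q)

    □-reflexiveClosure : (□ R a P x × P x) ⇔ □ R′ a Q x
    □-reflexiveClosure = mk⇔
      (λ (f , p) y r′ → forth f p y (to (R′⇔R⁼ y) r′))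
      (λ g → (λ y r → from (P⇔Q y) (g y (from (R′⇔R⁼ y) (inj₁ r))))
           , from (P⇔Q x) (g x (from (R′⇔R⁼ x) (inj₂ refl))))
      where
        forth : □ R a P x → P x → ∀ y → R x a y ⊎ x ≡ y → Q y
        forth f p y (inj₁ r) = to (P⇔Q y) (f y r)
        forth f p y (inj₂ refl) = to (P⇔Q x) p

module Translation {nAg nP : ℕ} (A : Subset nAg) (M : Model nAg nP)
  (R⁺ : W M → Fin nAg → W M → Set)
  (R⁺-on-A : ∀ {a} → a ∈ A → ∀ w v → R⁺ w a v ⇔ (R M w a v ⊎ w ≡ v))
  (R⁺-off-A : ∀ {a} → a ∉ A → ∀ w v → R⁺ w a v ⇔ R M w a v) where

  M⁺ : Model nAg nP
  M⁺ = record M { R = R⁺ }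

  -- Env M k and Env M⁺ k coincide, but extend {M = M} and extend {M = M⁺} are
  -- different terms, so the two environments can only be related pointwise.
  extend-cong : ∀ {k} {ρ : Env M k} {ρ⁺ : Env M⁺ k} → (∀ i w → ρ i w ≡ ρ⁺ i w) →
                ∀ S i w → extend {M = M} ρ S i w ≡ extend {M = M⁺} ρ⁺ S i w
  extend-cong ρ≗ρ⁺ S Fin.zero w = refl
  extend-cong ρ≗ρ⁺ S (Fin.suc i) w = ρ≗ρ⁺ i w

  ⟦tr⟧⇔⟦⟧ : ∀ {k} (φ : Fm nAg nP k) {ρ : Env M k} {ρ⁺ : Env M⁺ k} →
            (∀ i w → ρ i w ≡ ρ⁺ i w) → ∀ w → ⟦ tr A φ ⟧ M ρ w ⇔ ⟦ φ ⟧ M⁺ ρ⁺ w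
  ⟦tr⟧⇔⟦⟧ (prop p) ρ≗ρ⁺ w = ⇔-id _
  ⟦tr⟧⇔⟦⟧ (nprop p) ρ≗ρ⁺ w = ⇔-id _
  ⟦tr⟧⇔⟦⟧ tt ρ≗ρ⁺ w = ⇔-id _
  ⟦tr⟧⇔⟦⟧ ff ρ≗ρ⁺ w = ⇔-id _
  ⟦tr⟧⇔⟦⟧ (var i) ρ≗ρ⁺ w rewrite ρ≗ρ⁺ i w = ⇔-id _
  ⟦tr⟧⇔⟦⟧ (φ ∧′ ψ) ρ≗ρ⁺ w = ⟦tr⟧⇔⟦⟧ φ ρ≗ρ⁺ w ×-⇔ ⟦tr⟧⇔⟦⟧ ψ ρ≗ρ⁺ w
  ⟦tr⟧⇔⟦⟧ (φ ∨′ ψ) ρ≗ρ⁺ w = ⟦tr⟧⇔⟦⟧ φ ρ≗ρ⁺ w ⊎-⇔ ⟦tr⟧⇔⟦⟧ ψ ρ≗ρ⁺ w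
  ⟦tr⟧⇔⟦⟧ (dia a φ) ρ≗ρ⁺ w with a ∈? A
  ... | yes a∈A = ◇-reflexiveClosure (R M) R⁺ (⟦tr⟧⇔⟦⟧ φ ρ≗ρ⁺) (R⁺-on-A a∈A w)
  ... | no a∉A = ◇-cong (R M) R⁺ (⟦tr⟧⇔⟦⟧ φ ρ≗ρ⁺) (R⁺-off-A a∉A w)
  ⟦tr⟧⇔⟦⟧ (box a φ) ρ≗ρ⁺ w with a ∈? A
  ... | yes a∈A = □-reflexiveClosure (R M) R⁺ (⟦tr⟧⇔⟦⟧ φ ρ≗ρ⁺) (R⁺-on-A a∈A w)
  ... | no a∉A = □-cong (R M) R⁺ (⟦tr⟧⇔⟦⟧ φ ρ≗ρ⁺) (R⁺-off-A a∉A w)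
  ⟦tr⟧⇔⟦⟧ (μ′ φ) {ρ} {ρ⁺} ρ≗ρ⁺ w = mk⇔
    (λ f S closed → f S (λ v → closed v ∘ to (body S v)))
    (λ f S closed → f S (λ v → closed v ∘ from (body S v)))
    where
      body : ∀ S v → ⟦ tr A φ ⟧ M (extend {M = M} ρ S) v ⇔ ⟦ φ ⟧ M⁺ (extend {M = M⁺} ρ⁺ S) v
      body S = ⟦tr⟧⇔⟦⟧ φ (extend-cong ρ≗ρ⁺ S)
  ⟦tr⟧⇔⟦⟧ (ν′ φ) {ρ} {ρ⁺} ρ≗ρ⁺ w = mk⇔
    (λ (S , consistent , Sw) → S , (λ v → to (body S v) ∘ consistent v) , Sw)
    (λ (S , consistent , Sw) → S , (λ v → from (body S v) ∘ consistent v) , Sw)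
    where
      body : ∀ S v → ⟦ tr A φ ⟧ M (extend {M = M} ρ S) v ⇔ ⟦ φ ⟧ M⁺ (extend {M = M⁺} ρ⁺ S) v
      body S = ⟦tr⟧⇔⟦⟧ φ (extend-cong ρ≗ρ⁺ S)

  ⊨tr⇔⊨ : (φ : Formula nAg nP) (w : W M) → (M , w ⊨ tr A φ) ⇔ (M⁺ , w ⊨ φ)
  ⊨tr⇔⊨ φ = ⟦tr⟧⇔⟦⟧ φ (λ ())

module _ {nAg nP : ℕ} (A : Subset nAg) where

  reflexiveClosureOn : Model nAg nP → Model nAg nP
  reflexiveClosureOn M = record M { R = λ w a v → R M w a v ⊎ (a ∈ A × w ≡ v) }

  module _ (M : Model nAg nP) where

    reflexiveClosureOn-reflexive : ∀ {a} → a ∈ A → Reflexive (reflexiveClosureOn M) a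
    reflexiveClosureOn-reflexive a∈A w = inj₂ (a∈A , refl)

    reflexiveClosureOn-preserves : ∀ {a} c → Satisfies M a c → Satisfies (reflexiveClosureOn M) a c
    reflexiveClosureOn-preserves D serial w = let v , r = serial w in v , inj₁ r
    reflexiveClosureOn-preserves T reflexive w = inj₁ (reflexive w)
    reflexiveClosureOn-preserves B symmetric w v (inj₁ r) = inj₁ (symmetric w v r)
    reflexiveClosureOn-preserves B symmetric w v (inj₂ (a∈A , refl)) = inj₂ (a∈A , refl)

    ⊨tr⇔⊨reflexiveClosureOn : (φ : Formula nAg nP) (w : W M) →
                               (M , w ⊨ tr A φ) ⇔ (reflexiveClosureOn M , w ⊨ φ)
    ⊨tr⇔⊨reflexiveClosureOn = Translation.⊨tr⇔⊨ A M (R (reflexiveClosureOn M))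
      (λ a∈A w v → mk⇔ (λ { (inj₁ r) → inj₁ r ; (inj₂ (_ , w≡v)) → inj₂ w≡v })
                       (λ { (inj₁ r) → inj₁ r ; (inj₂ w≡v) → inj₂ (a∈A , w≡v) }))
      (λ a∉A w v → mk⇔ (λ { (inj₁ r) → r ; (inj₂ (a∈A , _)) → ⊥-elim (a∉A a∈A) }) inj₁)

    ⊨tr⇔⊨-reflexiveOn : (∀ {a} → a ∈ A → Reflexive M a) →
                        (φ : Formula nAg nP) (w : W M) → (M , w ⊨ tr A φ) ⇔ (M , w ⊨ φ)
    ⊨tr⇔⊨-reflexiveOn reflexive = Translation.⊨tr⇔⊨ A M (R M)
      (λ a∈A w v → mk⇔ inj₁ (λ { (inj₁ r) → r ; (inj₂ refl) → reflexive a∈A w }))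
      (λ _ w v → ⇔-id _)

module _ {nAg : ℕ} {A : Subset nAg} {L₁ L₂ : Logic nAg}
  (L₁-on-A : (a : Fin nAg) → a ∈ A → (c : Cond) → L₁ a c ≡ (L₂ a c ∨ isT c))
  (L₁-off-A : (a : Fin nAg) → a ∉ A → (c : Cond) → L₁ a c ≡ L₂ a c) where

  L₂⊆L₁ : ∀ a c → L₂ a c ≡ true → L₁ a c ≡ true
  L₂⊆L₁ a c L₂ac with a ∈? A
  ... | yes a∈A = trans (L₁-on-A a a∈A c) (cong (_∨ isT c) L₂ac)
  ... | no a∉A = trans (L₁-off-A a a∉A c) L₂ac

  L₁-T-on-A : ∀ a → a ∈ A → L₁ a T ≡ true
  L₁-T-on-A a a∈A = trans (L₁-on-A a a∈A T) (∨-zeroʳ (L₂ a T))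

  L₁⊆L₂∪T-on-A : ∀ a c → L₁ a c ≡ true → L₂ a c ≡ true ⊎ (a ∈ A × c ≡ T)
  L₁⊆L₂∪T-on-A a c L₁ac with a ∈? A
  ... | no a∉A = inj₁ (trans (sym (L₁-off-A a a∉A c)) L₁ac)
  ... | yes a∈A = on-A c (L₁-on-A a a∈A c) L₁ac
    where
      on-A : ∀ c → L₁ a c ≡ (L₂ a c ∨ isT c) → L₁ a c ≡ true → L₂ a c ≡ true ⊎ (a ∈ A × c ≡ T)
      on-A T _ _ = inj₂ (a∈A , refl)
      on-A D L₁aD≡ L₁aD = inj₁ (trans (sym (∨-identityʳ (L₂ a D))) (trans (sym L₁aD≡) L₁aD))
      on-A B L₁aB≡ L₁aB = inj₁ (trans (sym (∨-identityʳ (L₂ a B))) (trans (sym L₁aB≡) L₁aB))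

  reflexiveClosureOn-isL₁Model : ∀ {nP} {M : Model nAg nP} →
                                 IsLModel L₂ M → IsLModel L₁ (reflexiveClosureOn A M)
  reflexiveClosureOn-isL₁Model {M = M} M∈L₂ a c L₁ac with L₁⊆L₂∪T-on-A a c L₁ac
  ... | inj₁ L₂ac = reflexiveClosureOn-preserves A M c (M∈L₂ a c L₂ac)
  ... | inj₂ (a∈A , refl) = reflexiveClosureOn-reflexive A M a∈A

theorem3p16 : {nAg nP : ℕ} (A : Subset nAg) (L₁ L₂ : Logic nAg) →
    ((a : Fin nAg) → a ∈ A → (c : Cond) → L₁ a c ≡ (L₂ a c ∨ isT c)) →
    ((a : Fin nAg) → a ∉ A → (c : Cond) → L₁ a c ≡ L₂ a c) →
    ((a : Fin nAg) → L₂ a T ≡ false) →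
    (φ : Formula nAg nP) →
    Satisfiable L₁ φ ⇔ Satisfiable L₂ (tr A φ)
theorem3p16 A L₁ L₂ L₁-on-A L₁-off-A _ φ = mk⇔
  (λ (M , M∈L₁ , w , w⊨φ) →
     let reflexive-on-A = λ {a} a∈A → M∈L₁ a T (L₁-T-on-A L₁-on-A L₁-off-A a a∈A)
     in M , (λ a c → M∈L₁ a c ∘ L₂⊆L₁ L₁-on-A L₁-off-A a c) , w ,
        from (⊨tr⇔⊨-reflexiveOn A M reflexive-on-A φ w) w⊨φ)
  (λ (M , M∈L₂ , w , w⊨trφ) →
     reflexiveClosureOn A M , reflexiveClosureOn-isL₁Model L₁-on-A L₁-off-A M∈L₂ , w ,
     to (⊨tr⇔⊨reflexiveClosureOn A M φ w) w⊨trφ)
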